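{- Let $G=(V,E)$ be a graph, $c\ge1$, $\epsilon\in[0,1/3)$, let $\kappa(G)$ be an $(\epsilon,c)$-kernel of $G$ with tight nodes $\kappa_T(V)$, and let $M$ be a maximal matching in $\kappa(G)$. Let $F_T$ be the set of tight nodes that are unmatched in $M$. Then $|F_T|\le(2+6\epsilon)|M|$.
   Context: For $v\in V$ let $\mathcal{N}_v$ be its neighbors in $G$. A subgraph $\kappa(G)=(V,\kappa(E))$ with $\kappa(E)\subseteq E$, together with a partition of $V$ into tight nodes $\kappa_T(V)$ and slack nodes $\kappa_S(V)$, is an $(\epsilon,c)$-kernel of $G$ if, with $\kappa(\mathcal{N}_v)=\{u\in\mathcal{N}_v:(u,v)\in\kappa(E)\}$: (i) $|\kappa(\mathcal{N}_v)|\le(1+\epsilon)c$ for all $v\in V$; (ii) $|\kappa(\mathcal{N}_v)|\ge(1-\epsilon)c$ for all $v\in\kappa_T(V)$; (iii) every edge of $G$ joining two slack nodes lies in $\kappa(E)$.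
   Formalization: The kernel parameters ε and c range over the rationals. -}

module Defs where

open import Data.Nat as ℕ using (ℕ; zero; suc; _<ᵇ_; _≡ᵇ_)
open import Data.Bool using (Bool; true; false; if_then_else_; not; _∧_)
open import Data.Fin as Fin using (Fin; toℕ)
open import Data.Integer using (+_)
open import Data.Rational using (ℚ; _/_; _+_; _-_; _*_; _≤_; 1ℚ)
open import Data.Empty using (⊥)
open import Relation.Binary.PropositionalEquality using (_≡_)

sumFin : ∀ {n} → (Fin n → ℕ) → ℕ
sumFin {zero}  g = 0
sumFin {suc n} g = g Fin.zero ℕ.+ sumFin (λ i → g (Fin.suc i))

count : ∀ {n} → (Fin n → Bool) → ℕ
count f = sumFin (λ i → if f i then 1 else 0)

⟦_⟧ : ℕ → ℚ
⟦ n ⟧ = + n / 1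

record Graph (n : ℕ) : Set where
  field
    adj      : Fin n → Fin n → Bool
    sym      : ∀ u v → adj u v ≡ adj v u
    loopless : ∀ v → adj v v ≡ false
open Graph public

edgeCount : ∀ {n} → (Fin n → Fin n → Bool) → ℕ
edgeCount R = sumFin (λ u → count (λ v → (toℕ u <ᵇ toℕ v) ∧ R u v))

deg : ∀ {n} → (Fin n → Fin n → Bool) → Fin n → ℕ
deg K v = count (λ u → K v u)

record Kernel {n : ℕ} (G : Graph n) (ε c : ℚ) : Set where
  field
    K      : Fin n → Fin n → Bool
    K-sym  : ∀ u v → K u v ≡ K v u
    K-sub  : ∀ u v → K u v ≡ true → adj G u v ≡ true
    tight  : Fin n → Bool
    deg-upper : ∀ v → ⟦ deg K v ⟧ ≤ (1ℚ + ε) * c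
    deg-lower : ∀ v → tight v ≡ true → (1ℚ - ε) * c ≤ ⟦ deg K v ⟧
    slack-closed : ∀ u v → tight u ≡ false → tight v ≡ false →
                   adj G u v ≡ true → K u v ≡ true
open Kernel public

matched : ∀ {n} → (Fin n → Fin n → Bool) → Fin n → Bool
matched M v = not (deg M v ≡ᵇ 0)

record IsMatching {n : ℕ} (H : Fin n → Fin n → Bool) (M : Fin n → Fin n → Bool) : Set where
  field
    M-sym : ∀ u v → M u v ≡ M v u
    M-sub : ∀ u v → M u v ≡ true → H u v ≡ true
    M-deg : ∀ v → deg M v ℕ.≤ 1

record IsMaximalMatching {n : ℕ} (H : Fin n → Fin n → Bool) (M : Fin n → Fin n → Bool) : Set where
  field
    matching : IsMatching H M
    maximal  : ∀ u v → H u v ≡ true → matched M u ≡ false → matched M v ≡ false → ⊥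

unmatchedTight : ∀ {n} → (Fin n → Bool) → (Fin n → Fin n → Bool) → Fin n → Bool
unmatchedTight tight M v = tight v ∧ not (matched M v)

-- Every neighbour of an unmatched tight node v in the kernel is matched (else
-- M ∪ {uv} would still be a matching), and v has at least (1 − ε)c kernel
-- neighbours.  Double counting the kernel edges leaving the unmatched tight
-- nodes therefore gives
--   |F_T| (1 − ε) c ≤ Σ_{u matched} deg_κ u ≤ 2|M| (1 + ε) c,
-- and 2(1 + ε) ≤ (2 + 6ε)(1 − ε) because 2ε(1 − 3ε) ≥ 0 for 0 ≤ ε < 1/3.
module Submission where

open import Defs hiding (sym)
open import Data.Nat using (ℕ)
open import Data.Rational using (ℚ; _+_; _*_; _≤_; _<_; 0ℚ; 1ℚ; _/_)
open import Data.Integer using (+_)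
open import Data.Fin using (Fin)
open import Data.Bool using (Bool)

open import Data.Nat as ℕ using (zero; suc; z≤n; _<ᵇ_; _≡ᵇ_)
import Data.Nat.Properties as ℕ
import Data.Nat.Coprimality as Coprimality
import Data.Integer as ℤ
import Data.Integer.Properties as ℤ
open import Data.Rational as ℚ using (_-_; mkℚ; *≤*)
import Data.Rational.Properties as ℚ
open import Data.Rational.Solver using (module +-*-Solver)
open import Data.Fin as Fin using (toℕ)
import Data.Fin.Properties as Fin
import Algebra.Properties.CommutativeSemigroup as CommutativeSemigroupProperties
open import Data.Bool using (true; false; if_then_else_; not; _∧_; T)
open import Data.Unit using (tt)
open import Relation.Nullary.Decidable using (toWitness)
open import Relation.Binary.PropositionalEquality

private
  variable
    n : ℕ

indicator : Bool → ℕ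
indicator b = if b then 1 else 0

sumWhere : (Fin n → Bool) → (Fin n → ℕ) → ℕ
sumWhere P f = sumFin (λ v → if P v then f v else 0)

sumFin-cong : {f g : Fin n → ℕ} → (∀ i → f i ≡ g i) → sumFin f ≡ sumFin g
sumFin-cong {zero}  f≡g = refl
sumFin-cong {suc n} f≡g = cong₂ ℕ._+_ (f≡g Fin.zero) (sumFin-cong (λ i → f≡g (Fin.suc i)))

sumFin-mono : {f g : Fin n → ℕ} → (∀ i → f i ℕ.≤ g i) → sumFin f ℕ.≤ sumFin g
sumFin-mono {zero}  f≤g = z≤n
sumFin-mono {suc n} f≤g = ℕ.+-mono-≤ (f≤g Fin.zero) (sumFin-mono (λ i → f≤g (Fin.suc i)))

sumFin-zero : sumFin {n} (λ _ → 0) ≡ 0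
sumFin-zero {zero}  = refl
sumFin-zero {suc n} = sumFin-zero {n}

sumFin-+ : (f g : Fin n → ℕ) → sumFin (λ i → f i ℕ.+ g i) ≡ sumFin f ℕ.+ sumFin g
sumFin-+ {zero}  f g = refl
sumFin-+ {suc n} f g =
  trans (cong (f Fin.zero ℕ.+ g Fin.zero ℕ.+_)
               (sumFin-+ (λ i → f (Fin.suc i)) (λ i → g (Fin.suc i))))
        (+-interchange (f Fin.zero) (g Fin.zero) _ _)
  where open CommutativeSemigroupProperties ℕ.+-commutativeSemigroup
          renaming (interchange to +-interchange)

sumFin-swap : ∀ {m} (f : Fin m → Fin n → ℕ) →
  sumFin (λ i → sumFin (λ j → f i j)) ≡ sumFin (λ j → sumFin (λ i → f i j))
sumFin-swap {n} {zero} f = sym (sumFin-zero {n})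
sumFin-swap {m = suc m} f = begin
  sumFin (f Fin.zero) ℕ.+ sumFin (λ i → sumFin (λ j → f (Fin.suc i) j))
    ≡⟨ cong (sumFin (f Fin.zero) ℕ.+_) (sumFin-swap (λ i → f (Fin.suc i))) ⟩
  sumFin (f Fin.zero) ℕ.+ sumFin (λ j → sumFin (λ i → f (Fin.suc i) j))
    ≡⟨ sumFin-+ (f Fin.zero) (λ j → sumFin (λ i → f (Fin.suc i) j)) ⟨
  sumFin (λ j → f Fin.zero j ℕ.+ sumFin (λ i → f (Fin.suc i) j)) ∎
  where open ≡-Reasoning

if-sumFin : (b : Bool) (f : Fin n → ℕ) →
  (if b then sumFin f else 0) ≡ sumFin (λ u → if b then f u else 0)
if-sumFin     true  f = refl
if-sumFin {n} false f = sym (sumFin-zero {n})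

-- Each ordered pair (v, u) with R v u is counted by edgeCount R in exactly one
-- orientation, since loops are excluded.
module _ (R : Fin n → Fin n → Bool)
         (R-sym : ∀ u v → R u v ≡ R v u)
         (R-loopless : ∀ v → R v v ≡ false) where

  private
    forward : Fin n → Fin n → ℕ
    forward v u = indicator ((toℕ v <ᵇ toℕ u) ∧ R v u)

    <ᵇ-true : ∀ a b → (a <ᵇ b) ≡ true → a ℕ.< b
    <ᵇ-true a b eq = ℕ.<ᵇ⇒< a b (subst T (sym eq) tt)

    <ᵇ-false : ∀ a b → (a <ᵇ b) ≡ false → b ℕ.≤ a
    <ᵇ-false a b eq = ℕ.≮⇒≥ (λ a<b → subst T eq (ℕ.<⇒<ᵇ a<b))

    indicator-split : ∀ v u → indicator (R v u) ≡ forward v u ℕ.+ forward u v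
    indicator-split v u with toℕ v <ᵇ toℕ u in v<u | toℕ u <ᵇ toℕ v in u<v
    ... | true  | true
      with () ← ℕ.<-asym (<ᵇ-true (toℕ v) (toℕ u) v<u) (<ᵇ-true (toℕ u) (toℕ v) u<v)
    ... | true  | false = sym (ℕ.+-identityʳ (indicator (R v u)))
    ... | false | true  = cong indicator (R-sym v u)
    ... | false | false
      with refl ← Fin.toℕ-injective {i = v} {j = u}
                    (ℕ.≤-antisym (<ᵇ-false (toℕ u) (toℕ v) u<v) (<ᵇ-false (toℕ v) (toℕ u) v<u))
      = cong indicator (R-loopless v)

  handshake : sumFin (deg R) ≡ edgeCount R ℕ.+ edgeCount R
  handshake = begin
    sumFin (λ v → sumFin (λ u → indicator (R v u)))
      ≡⟨ sumFin-cong (λ v → sumFin-cong (indicator-split v)) ⟩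
    sumFin (λ v → sumFin (λ u → forward v u ℕ.+ forward u v))
      ≡⟨ sumFin-cong (λ v → sumFin-+ (forward v) (λ u → forward u v)) ⟩
    sumFin (λ v → sumFin (forward v) ℕ.+ sumFin (λ u → forward u v))
      ≡⟨ sumFin-+ (λ v → sumFin (forward v)) (λ v → sumFin (λ u → forward u v)) ⟩
    edgeCount R ℕ.+ sumFin (λ v → sumFin (λ u → forward u v))
      ≡⟨ cong (edgeCount R ℕ.+_) (sumFin-swap (λ v u → forward u v)) ⟩
    edgeCount R ℕ.+ edgeCount R ∎
    where open ≡-Reasoning

indicator-matched : ∀ d → d ℕ.≤ 1 → indicator (not (d ≡ᵇ 0)) ≡ d
indicator-matched zero          _ = refl
indicator-matched (suc zero)    _ = refl
indicator-matched (suc (suc d)) (ℕ.s≤s ())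

count-matched : {H M : Fin n → Fin n → Bool} → IsMatching H M →
  (∀ v → H v v ≡ false) → count (matched M) ≡ edgeCount M ℕ.+ edgeCount M
count-matched {M = M} isMatching H-loopless = begin
  count (matched M)       ≡⟨ sumFin-cong (λ v → indicator-matched (deg M v) (M-deg v)) ⟩
  sumFin (deg M)          ≡⟨ handshake M M-sym M-loopless ⟩
  edgeCount M ℕ.+ edgeCount M ∎
  where
    open ≡-Reasoning
    open IsMatching isMatching
    M-loopless : ∀ v → M v v ≡ false
    M-loopless v with M v v in eq
    ... | true  = trans (sym (M-sub v v eq)) (H-loopless v)
    ... | false = refl

guarded-indicator-mono : ∀ p r q → (p ≡ true → r ≡ true → q ≡ true) →
  (if p then indicator r else 0) ℕ.≤ (if q then indicator r else 0)
guarded-indicator-mono false r     q     _ = z≤n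
guarded-indicator-mono true  false q     _ = z≤n
guarded-indicator-mono true  true  true  _ = ℕ.≤-refl
guarded-indicator-mono true  true  false h with () ← h refl refl

sumWhere-deg-mono : (R : Fin n → Fin n → Bool) → (∀ u v → R u v ≡ R v u) →
  (P Q : Fin n → Bool) → (∀ v u → P v ≡ true → R v u ≡ true → Q u ≡ true) →
  sumWhere P (deg R) ℕ.≤ sumWhere Q (deg R)
sumWhere-deg-mono R R-sym P Q P→Q = begin
  sumFin (λ v → if P v then deg R v else 0)
    ≡⟨ sumFin-cong (λ v → if-sumFin (P v) (λ u → indicator (R v u))) ⟩
  sumFin (λ v → sumFin (λ u → if P v then indicator (R v u) else 0))
    ≤⟨ sumFin-mono (λ v → sumFin-mono (λ u →
         guarded-indicator-mono (P v) (R v u) (Q u) (P→Q v u))) ⟩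
  sumFin (λ v → sumFin (λ u → if Q u then indicator (R v u) else 0))
    ≡⟨ sumFin-swap (λ v u → if Q u then indicator (R v u) else 0) ⟩
  sumFin (λ u → sumFin (λ v → if Q u then indicator (R v u) else 0))
    ≡⟨ sumFin-cong (λ u → sumFin-cong (λ v →
         cong (λ b → if Q u then indicator b else 0) (R-sym v u))) ⟩
  sumFin (λ u → sumFin (λ v → if Q u then indicator (R u v) else 0))
    ≡⟨ sumFin-cong (λ u → if-sumFin (Q u) (λ v → indicator (R u v))) ⟨
  sumFin (λ u → if Q u then deg R u else 0) ∎
  where open ℕ.≤-Reasoning

⟦⟧≡mkℚ : ∀ a → ⟦ a ⟧ ≡ mkℚ (+ a) 0 (Coprimality.sym (Coprimality.1-coprimeTo a))
⟦⟧≡mkℚ a = ℚ.normalize-coprime (Coprimality.sym (Coprimality.1-coprimeTo a))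

⟦⟧-homo-+ : ∀ a b → ⟦ a ℕ.+ b ⟧ ≡ ⟦ a ⟧ + ⟦ b ⟧
⟦⟧-homo-+ a b rewrite ⟦⟧≡mkℚ a | ⟦⟧≡mkℚ b =
  ℚ./-cong {p₁ = + (a ℕ.+ b)} {q₁ = 1} numerators refl
  where
    numerators : + (a ℕ.+ b) ≡ + a ℤ.* + 1 ℤ.+ + b ℤ.* + 1
    numerators rewrite ℤ.*-identityʳ (+ a) | ℤ.*-identityʳ (+ b) = ℤ.pos-+ a b

⟦⟧-mono-≤ : ∀ {a b} → a ℕ.≤ b → ⟦ a ⟧ ≤ ⟦ b ⟧
⟦⟧-mono-≤ {a} {b} a≤b rewrite ⟦⟧≡mkℚ a | ⟦⟧≡mkℚ b =
  *≤* (subst₂ ℤ._≤_ (sym (ℤ.*-identityʳ (+ a))) (sym (ℤ.*-identityʳ (+ b))) (ℤ.+≤+ a≤b))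

⟦⟧-*-distrib-+ : ∀ a b (x : ℚ) → ⟦ a ℕ.+ b ⟧ * x ≡ ⟦ a ⟧ * x + ⟦ b ⟧ * x
⟦⟧-*-distrib-+ a b x = trans (cong (_* x) (⟦⟧-homo-+ a b)) (ℚ.*-distribʳ-+ x ⟦ a ⟧ ⟦ b ⟧)

sumFin-scaled-≤ : (g f : Fin n → ℕ) (x : ℚ) →
  (∀ i → ⟦ g i ⟧ * x ≤ ⟦ f i ⟧) → ⟦ sumFin g ⟧ * x ≤ ⟦ sumFin f ⟧
sumFin-scaled-≤ {zero}  g f x _ = ℚ.≤-reflexive (ℚ.*-zeroˡ x)
sumFin-scaled-≤ {suc n} g f x gx≤f = begin
  ⟦ sumFin g ⟧ * x
    ≡⟨ ⟦⟧-*-distrib-+ (g Fin.zero) G x ⟩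
  ⟦ g Fin.zero ⟧ * x + ⟦ G ⟧ * x
    ≤⟨ ℚ.+-mono-≤ (gx≤f Fin.zero) (sumFin-scaled-≤ _ _ x (λ i → gx≤f (Fin.suc i))) ⟩
  ⟦ f Fin.zero ⟧ + ⟦ F ⟧
    ≡⟨ ⟦⟧-homo-+ (f Fin.zero) F ⟨
  ⟦ sumFin f ⟧ ∎
  where
    open ℚ.≤-Reasoning
    G = sumFin (λ i → g (Fin.suc i))
    F = sumFin (λ i → f (Fin.suc i))

sumFin-≤-scaled : (f g : Fin n → ℕ) (x : ℚ) →
  (∀ i → ⟦ f i ⟧ ≤ ⟦ g i ⟧ * x) → ⟦ sumFin f ⟧ ≤ ⟦ sumFin g ⟧ * x
sumFin-≤-scaled {zero}  f g x _ = ℚ.≤-reflexive (sym (ℚ.*-zeroˡ x))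
sumFin-≤-scaled {suc n} f g x f≤gx = begin
  ⟦ sumFin f ⟧
    ≡⟨ ⟦⟧-homo-+ (f Fin.zero) F ⟩
  ⟦ f Fin.zero ⟧ + ⟦ F ⟧
    ≤⟨ ℚ.+-mono-≤ (f≤gx Fin.zero) (sumFin-≤-scaled _ _ x (λ i → f≤gx (Fin.suc i))) ⟩
  ⟦ g Fin.zero ⟧ * x + ⟦ G ⟧ * x
    ≡⟨ ⟦⟧-*-distrib-+ (g Fin.zero) G x ⟨
  ⟦ sumFin g ⟧ * x ∎
  where
    open ℚ.≤-Reasoning
    G = sumFin (λ i → g (Fin.suc i))
    F = sumFin (λ i → f (Fin.suc i))

indicator-scaled-≤ : ∀ b d (x : ℚ) → (b ≡ true → x ≤ ⟦ d ⟧) →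
  ⟦ indicator b ⟧ * x ≤ ⟦ if b then d else 0 ⟧
indicator-scaled-≤ true  d x x≤d = subst (_≤ ⟦ d ⟧) (sym (ℚ.*-identityˡ x)) (x≤d refl)
indicator-scaled-≤ false d x _   = ℚ.≤-reflexive (ℚ.*-zeroˡ x)

≤-indicator-scaled : ∀ b d (x : ℚ) → (b ≡ true → ⟦ d ⟧ ≤ x) →
  ⟦ if b then d else 0 ⟧ ≤ ⟦ indicator b ⟧ * x
≤-indicator-scaled true  d x d≤x = subst (⟦ d ⟧ ≤_) (sym (ℚ.*-identityˡ x)) (d≤x refl)
≤-indicator-scaled false d x _   = ℚ.≤-reflexive (sym (ℚ.*-zeroˡ x))

count-scaled-≤-sumWhere : (P : Fin n → Bool) (f : Fin n → ℕ) (x : ℚ) →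
  (∀ v → P v ≡ true → x ≤ ⟦ f v ⟧) → ⟦ count P ⟧ * x ≤ ⟦ sumWhere P f ⟧
count-scaled-≤-sumWhere P f x x≤f =
  sumFin-scaled-≤ _ _ x (λ v → indicator-scaled-≤ (P v) (f v) x (x≤f v))

sumWhere-≤-count-scaled : (P : Fin n → Bool) (f : Fin n → ℕ) (x : ℚ) →
  (∀ v → P v ≡ true → ⟦ f v ⟧ ≤ x) → ⟦ sumWhere P f ⟧ ≤ ⟦ count P ⟧ * x
sumWhere-≤-count-scaled P f x f≤x =
  sumFin-≤-scaled _ _ x (λ v → ≤-indicator-scaled (P v) (f v) x (f≤x v))

p≤q⇒0≤q-p : ∀ {p q} → p ≤ q → 0ℚ ≤ q - p
p≤q⇒0≤q-p {p} {q} p≤q = subst (_≤ q - p) (ℚ.+-inverseʳ p) (ℚ.+-monoˡ-≤ (ℚ.- p) p≤q)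

p<q⇒0<q-p : ∀ {p q} → p < q → 0ℚ < q - p
p<q⇒0<q-p {p} {q} p<q = subst (_< q - p) (ℚ.+-inverseʳ p) (ℚ.+-monoˡ-< (ℚ.- p) p<q)

0≤p⇒0≤q⇒0≤p*q : ∀ {p q} → 0ℚ ≤ p → 0ℚ ≤ q → 0ℚ ≤ p * q
0≤p⇒0≤q⇒0≤p*q {p} {q} 0≤p 0≤q = ℚ.nonNegative⁻¹ (p * q)
  {{ℚ.nonNeg*nonNeg⇒nonNeg p {{ℚ.nonNegative 0≤p}} q {{ℚ.nonNegative 0≤q}}}}

[m+m][1+ε]≤[2+6ε]m[1-ε] : (m ε : ℚ) → 0ℚ ≤ m → 0ℚ ≤ ε → ε < + 1 / 3 →
  (m + m) * (1ℚ + ε) ≤ (+ 2 / 1 + + 6 / 1 * ε) * m * (1ℚ - ε)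
[m+m][1+ε]≤[2+6ε]m[1-ε] m ε 0≤m 0≤ε ε<⅓ = begin
  (m + m) * (1ℚ + ε)
    ≡⟨ ℚ.+-identityʳ _ ⟨
  (m + m) * (1ℚ + ε) + 0ℚ
    ≤⟨ ℚ.+-monoʳ-≤ ((m + m) * (1ℚ + ε)) surplus-nonneg ⟩
  (m + m) * (1ℚ + ε) + m * ε * (+ 2 / 1 - + 6 / 1 * ε)
    ≡⟨ identity m ε ⟨
  (+ 2 / 1 + + 6 / 1 * ε) * m * (1ℚ - ε) ∎
  where
    open ℚ.≤-Reasoning
    open +-*-Solver
    surplus-nonneg : 0ℚ ≤ m * ε * (+ 2 / 1 - + 6 / 1 * ε)
    surplus-nonneg = 0≤p⇒0≤q⇒0≤p*q (0≤p⇒0≤q⇒0≤p*q 0≤m 0≤ε)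
                       (p≤q⇒0≤q-p (ℚ.<⇒≤ (ℚ.*-monoʳ-<-pos (+ 6 / 1) ε<⅓)))
    identity : ∀ m ε → (+ 2 / 1 + + 6 / 1 * ε) * m * (1ℚ - ε)
                     ≡ (m + m) * (1ℚ + ε) + m * ε * (+ 2 / 1 - + 6 / 1 * ε)
    identity = solve 2 (λ m ε →
      (con (+ 2 / 1) :+ con (+ 6 / 1) :* ε) :* m :* (con 1ℚ :- ε)
        := (m :+ m) :* (con 1ℚ :+ ε) :+ m :* ε :* (con (+ 2 / 1) :- con (+ 6 / 1) :* ε)) refl

kernel-ratio-bound : (x m ε c : ℚ) → 1ℚ ≤ c → 0ℚ ≤ ε → ε < + 1 / 3 → 0ℚ ≤ m →
  x * ((1ℚ - ε) * c) ≤ (m + m) * ((1ℚ + ε) * c) → x ≤ (+ 2 / 1 + + 6 / 1 * ε) * m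
kernel-ratio-bound x m ε c 1≤c 0≤ε ε<⅓ 0≤m bound =
  ℚ.*-cancelʳ-≤-pos (1ℚ - ε) {{ℚ.positive (p<q⇒0<q-p ε<1)}}
    (ℚ.≤-trans bound-without-c ([m+m][1+ε]≤[2+6ε]m[1-ε] m ε 0≤m 0≤ε ε<⅓))
  where
    ε<1 : ε < 1ℚ
    ε<1 = ℚ.<-trans ε<⅓ (toWitness {a? = + 1 / 3 ℚ.<? 1ℚ} tt)
    0<c : 0ℚ < c
    0<c = ℚ.<-≤-trans (toWitness {a? = 0ℚ ℚ.<? 1ℚ} tt) 1≤c
    bound-without-c : x * (1ℚ - ε) ≤ (m + m) * (1ℚ + ε)
    bound-without-c = ℚ.*-cancelʳ-≤-pos c {{ℚ.positive 0<c}}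
      (subst₂ _≤_ (sym (ℚ.*-assoc x _ c)) (sym (ℚ.*-assoc (m + m) _ c)) bound)

unmatchedTight⇒tight : ∀ tight M (v : Fin n) →
  unmatchedTight tight M v ≡ true → tight v ≡ true
unmatchedTight⇒tight tight M v v∈F-T with tight v
... | true = refl

unmatchedTight⇒unmatched : ∀ tight M (v : Fin n) →
  unmatchedTight tight M v ≡ true → matched M v ≡ false
unmatchedTight⇒unmatched tight M v v∈F-T with tight v | matched M v
... | true | false = refl

maximal-matching-saturates : ∀ {H M : Fin n → Fin n → Bool} → IsMaximalMatching H M →
  ∀ v u → H v u ≡ true → matched M v ≡ false → matched M u ≡ true
maximal-matching-saturates {M = M} maximalMatching v u vu∈H v-unmatched
  with matched M u in u-matched
... | true  = refl
... | false with () ← IsMaximalMatching.maximal maximalMatching v u vu∈H v-unmatched u-matched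

kernel-loopless : ∀ {G : Graph n} {ε c} (κ : Kernel G ε c) → ∀ v → K κ v v ≡ false
kernel-loopless {G = G} κ v with K κ v v in vv∈κ
... | false = refl
... | true  with () ← trans (sym (K-sub κ v v vv∈κ)) (loopless G v)

lemma3p12 : (n : ℕ) (G : Graph n) (ε c : ℚ) →
    1ℚ ≤ c → 0ℚ ≤ ε → ε < + 1 / 3 →
    (κ : Kernel G ε c) →
    (M : Fin n → Fin n → Bool) → IsMaximalMatching (K κ) M →
    ⟦ count (unmatchedTight (tight κ) M) ⟧ ≤ (+ 2 / 1 + + 6 / 1 * ε) * ⟦ edgeCount M ⟧
lemma3p12 n G ε c 1≤c 0≤ε ε<⅓ κ M maximalMatching =
  kernel-ratio-bound ⟦ count F-T ⟧ ⟦ edgeCount M ⟧ ε c 1≤c 0≤ε ε<⅓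
    (⟦⟧-mono-≤ (z≤n {edgeCount M})) double-count
  where
    open IsMaximalMatching maximalMatching using (matching)
    F-T = unmatchedTight (tight κ) M
    κ-deg = deg (K κ)

    neighbours-matched : ∀ v u → F-T v ≡ true → K κ v u ≡ true → matched M u ≡ true
    neighbours-matched v u v∈F-T vu∈κ =
      maximal-matching-saturates maximalMatching v u vu∈κ
        (unmatchedTight⇒unmatched (tight κ) M v v∈F-T)

    double-count : ⟦ count F-T ⟧ * ((1ℚ - ε) * c)
                 ≤ (⟦ edgeCount M ⟧ + ⟦ edgeCount M ⟧) * ((1ℚ + ε) * c)
    double-count = begin
      ⟦ count F-T ⟧ * ((1ℚ - ε) * c)
        ≤⟨ count-scaled-≤-sumWhere F-T κ-deg _
             (λ v v∈F-T → deg-lower κ v (unmatchedTight⇒tight (tight κ) M v v∈F-T)) ⟩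
      ⟦ sumWhere F-T κ-deg ⟧
        ≤⟨ ⟦⟧-mono-≤ (sumWhere-deg-mono (K κ) (K-sym κ) F-T (matched M) neighbours-matched) ⟩
      ⟦ sumWhere (matched M) κ-deg ⟧
        ≤⟨ sumWhere-≤-count-scaled (matched M) κ-deg _ (λ v _ → deg-upper κ v) ⟩
      ⟦ count (matched M) ⟧ * ((1ℚ + ε) * c)
        ≡⟨ cong (λ k → ⟦ k ⟧ * ((1ℚ + ε) * c)) (count-matched matching (kernel-loopless κ)) ⟩
      ⟦ edgeCount M ℕ.+ edgeCount M ⟧ * ((1ℚ + ε) * c)
        ≡⟨ cong (_* ((1ℚ + ε) * c)) (⟦⟧-homo-+ (edgeCount M) (edgeCount M)) ⟩
      (⟦ edgeCount M ⟧ + ⟦ edgeCount M ⟧) * ((1ℚ + ε) * c) ∎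
      where open ℚ.≤-Reasoning
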